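{- For all $\lambda H$-terms $T,U_1,\ldots,U_n$ ($n\ge 0$), $E(T\,U_1\ldots U_n)=E(E(T)\,E(U_1)\ldots E(U_n))$.
   Context: $\lambda H$-terms are the $\lambda$-terms built from variables and one additional constant $H$ by abstraction and application. Application is left-associative: $T\,U_1\ldots U_n$ means $(\ldots(T\,U_1)\ldots U_n)$. The map $E$ on $\lambda H$-terms is defined by induction: $E(x)=x$ for variables $x$; $E(H)=H$; $E(\lambda x\,U)=\lambda x\,E(U)$; $E(U\,V)=E(U)\,E(V)$ if $U$ is not of the form $H\,U_1\ldots U_n$ with $n\ge 0$; and $E(H\,U_1U_2\ldots U_n)=E(U_1U_2\ldots U_n)$ for $n\ge1$. -}

module Defs where

open import Data.Nat using (ℕ; zero; suc; _+_)
open import Data.List using (List; []; _∷_; foldl)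

data Term : Set where
  var : ℕ → Term
  H   : Term
  lam : ℕ → Term → Term
  app : Term → Term → Term

apps : Term → List Term → Term
apps t us = foldl app t us

size : Term → ℕ
size (var x)   = 1
size H         = 1
size (lam x u) = suc (size u)
size (app u v) = suc (size u + size v)

-- If t is of the form H U₁ … Uₙ with n ≥ 1, return U₁ … Uₙ; tag tells the shape.
data HView : Set where
  isH      : HView
  isHapp   : Term → HView
  notH     : HView

hview : Term → HView
hview H = isH
hview (app u v) with hview u
... | isH      = isHapp v
... | isHapp w = isHapp (app w v)
... | notH     = notH
hview _ = notH

-- The map E, computed with fuel (the size of the term suffices, since each
-- clause recurses on a strictly smaller term); fuel exhaustion never happens
-- when started with size t.
Ef : ℕ → Term → Term
Ef zero t = t
Ef (suc k) (var x)   = var x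
Ef (suc k) H         = H
Ef (suc k) (lam x u) = lam x (Ef k u)
Ef (suc k) (app u v) with hview (app u v)
... | isHapp w = Ef k w
... | _        = app (Ef k u) (Ef k v)

E : Term → Term
E t = Ef (size t) t

-- E only ever removes the constant H from the head of an application spine, and it does
-- so recursively along the spine. Hence on T U₁ … Uₙ it either strips H from the head of T
-- (and E(T) strips the same H), or T has a rigid head (a variable or an abstraction), in
-- which case E acts componentwise on the spine. A course-of-values induction on the size
-- of T plus the sizes of the Uᵢ then reduces the equation to the idempotence of E on
-- smaller terms, which is the case n = 0 of the same statement.
module Submission where

open import Defs
open import Data.List using (List; []; _∷_; map)
open import Data.Nat using (ℕ; zero; suc; _+_; _≤_; _<_; z≤n; s≤s)
open import Data.Nat.ListAction using (sum)
open import Data.Nat.Properties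
open import Data.Product using (_×_; _,_)
open import Relation.Binary.PropositionalEquality using (_≡_; refl; sym; cong; cong₂; module ≡-Reasoning)
open import Relation.Nullary using (contradiction)

0<size : ∀ t → 0 < size t
0<size (var _)   = s≤s z≤n
0<size H         = s≤s z≤n
0<size (lam _ _) = s≤s z≤n
0<size (app _ _) = s≤s z≤n

size-app-≤ : ∀ {u v k} → size (app u v) ≤ suc k → size u ≤ k × size v ≤ k
size-app-≤ {u} {v} (s≤s uv≤k) = ≤-trans (m≤m+n _ _) uv≤k , ≤-trans (m≤n+m _ (size u)) uv≤k

hview-isH : ∀ t → hview t ≡ isH → t ≡ H
hview-isH H refl = refl
hview-isH (app u v) eq with hview u
hview-isH (app u v) () | isH
hview-isH (app u v) () | isHapp _
hview-isH (app u v) () | notH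

hview-app-notH⁺ : ∀ u {v} → hview u ≡ notH → hview (app u v) ≡ notH
hview-app-notH⁺ _ eq rewrite eq = refl

hview-app-notH⁻ : ∀ u {v} → hview (app u v) ≡ notH → hview u ≡ notH
hview-app-notH⁻ u eq with hview u
hview-app-notH⁻ _ () | isH
hview-app-notH⁻ _ () | isHapp _
hview-app-notH⁻ _ _  | notH = refl

hview-app-isHapp⁺ : ∀ u {v w} → hview u ≡ isHapp w → hview (app u v) ≡ isHapp (app w v)
hview-app-isHapp⁺ _ eq rewrite eq = refl

hview-isHapp-size : ∀ t {w} → hview t ≡ isHapp w → size w < size t
hview-isHapp-size (app u v) eq with hview u in eq′
hview-isHapp-size (app u v) refl | isH = s≤s (m≤n+m (size v) (size u))
hview-isHapp-size (app u v) refl | isHapp w = s≤s (+-monoˡ-≤ (size v) (hview-isHapp-size u eq′))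
hview-isHapp-size (app u v) () | notH

hview-apps-isHapp : ∀ t {w} as → hview t ≡ isHapp w → hview (apps t as) ≡ isHapp (apps w as)
hview-apps-isHapp t []       eq = eq
hview-apps-isHapp t (a ∷ as) eq = hview-apps-isHapp (app t a) as (hview-app-isHapp⁺ t eq)

mutual
  Ef-fuel-irrelevant : ∀ {j k} t → size t ≤ j → size t ≤ k → Ef j t ≡ Ef k t
  Ef-fuel-irrelevant {zero} t t≤0 _ = contradiction t≤0 (<⇒≱ (0<size t))
  Ef-fuel-irrelevant {suc _} {zero} t _ t≤0 = contradiction t≤0 (<⇒≱ (0<size t))
  Ef-fuel-irrelevant {suc j} {suc k} (var x)   _ _ = refl
  Ef-fuel-irrelevant {suc j} {suc k} H         _ _ = refl
  Ef-fuel-irrelevant {suc j} {suc k} (lam x u) (s≤s u≤j) (s≤s u≤k) =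
    cong (lam x) (Ef-fuel-irrelevant u u≤j u≤k)
  Ef-fuel-irrelevant {suc j} {suc k} (app u v) uv≤j uv≤k with hview (app u v) in eq
  ... | isH      = Ef-fuel-irrelevant-app u v uv≤j uv≤k
  ... | notH     = Ef-fuel-irrelevant-app u v uv≤j uv≤k
  ... | isHapp w = Ef-fuel-irrelevant w (≤-pred (<-≤-trans (hview-isHapp-size (app u v) eq) uv≤j))
                                        (≤-pred (<-≤-trans (hview-isHapp-size (app u v) eq) uv≤k))

  Ef-fuel-irrelevant-app : ∀ {j k} u v → size (app u v) ≤ suc j → size (app u v) ≤ suc k →
                           app (Ef j u) (Ef j v) ≡ app (Ef k u) (Ef k v)
  Ef-fuel-irrelevant-app u v uv≤j uv≤k with size-app-≤ {u} {v} uv≤j | size-app-≤ {u} {v} uv≤k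
  ... | u≤j , v≤j | u≤k , v≤k =
    cong₂ app (Ef-fuel-irrelevant u u≤j u≤k) (Ef-fuel-irrelevant v v≤j v≤k)

Ef-enough-fuel : ∀ {k} t → size t ≤ k → Ef k t ≡ E t
Ef-enough-fuel t t≤k = Ef-fuel-irrelevant t t≤k ≤-refl

E-app-rigid : ∀ u v → hview u ≡ notH → E (app u v) ≡ app (E u) (E v)
E-app-rigid u v eq rewrite eq =
  cong₂ app (Ef-enough-fuel u (m≤m+n _ _)) (Ef-enough-fuel v (m≤n+m _ (size u)))

E-isHapp : ∀ t {w} → hview t ≡ isHapp w → E t ≡ E w
E-isHapp (app u v) {w} eq rewrite eq =
  Ef-enough-fuel w (≤-pred (hview-isHapp-size (app u v) eq))

E-apps-rigid : ∀ t as → hview t ≡ notH → E (apps t as) ≡ apps (E t) (map E as)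
E-apps-rigid t []       eq = refl
E-apps-rigid t (a ∷ as) eq = begin
  E (apps (app t a) as)             ≡⟨ E-apps-rigid (app t a) as (hview-app-notH⁺ t eq) ⟩
  apps (E (app t a)) (map E as)     ≡⟨ cong (λ s → apps s (map E as)) (E-app-rigid t a eq) ⟩
  apps (app (E t) (E a)) (map E as) ∎
  where open ≡-Reasoning

E-apps-isHapp : ∀ t {w} as → hview t ≡ isHapp w → E (apps t as) ≡ E (apps w as)
E-apps-isHapp t as eq = E-isHapp (apps t as) (hview-apps-isHapp t as eq)

Commutes : Term → List Term → Set
Commutes T Us = E (apps T Us) ≡ E (apps (E T) (map E Us))

weight : Term → List Term → ℕ
weight T Us = size T + sum (map size Us)

CommutesBelow : ℕ → Set
CommutesBelow n = ∀ T Us → weight T Us < n → Commutes T Us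

E-idempotent-below : ∀ {n} t → CommutesBelow n → size t < n → E t ≡ E (E t)
E-idempotent-below t ih t<n = ih t [] (≤-<-trans (≤-reflexive (+-identityʳ (size t))) t<n)

map-E-idempotent-below : ∀ {n} Us → CommutesBelow n → sum (map size Us) < n →
                         map E Us ≡ map E (map E Us)
map-E-idempotent-below []       ih _    = refl
map-E-idempotent-below (u ∷ us) ih u∷us<n =
  cong₂ _∷_ (E-idempotent-below u ih (≤-<-trans (m≤m+n _ _) u∷us<n))
            (map-E-idempotent-below us ih (≤-<-trans (m≤n+m _ (size u)) u∷us<n))

commutes-H : ∀ Us → CommutesBelow (weight H Us) → Commutes H Us
commutes-H []       _  = refl
commutes-H (a ∷ as) ih = begin
  E (apps (app H a) as)                ≡⟨ E-apps-isHapp (app H a) as refl ⟩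
  E (apps a as)                        ≡⟨ ih a as (n<1+n _) ⟩
  E (apps (E a) (map E as))            ≡⟨ E-apps-isHapp (app H (E a)) (map E as) refl ⟨
  E (apps (app H (E a)) (map E as))    ∎
  where open ≡-Reasoning

commutes-isHapp : ∀ T Us {w} → hview T ≡ isHapp w → CommutesBelow (weight T Us) → Commutes T Us
commutes-isHapp T Us {w} eq ih = begin
  E (apps T Us)                  ≡⟨ E-apps-isHapp T Us eq ⟩
  E (apps w Us)                  ≡⟨ ih w Us (+-monoˡ-< (sum (map size Us)) (hview-isHapp-size T eq)) ⟩
  E (apps (E w) (map E Us))      ≡⟨ cong (λ s → E (apps s (map E Us))) (E-isHapp T eq) ⟨
  E (apps (E T) (map E Us))      ∎
  where open ≡-Reasoning

commutes-rigid : ∀ T Us → hview T ≡ notH → CommutesBelow (weight T Us) → Commutes T Us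
commutes-rigid (var x) Us _ ih = begin
  E (apps (var x) Us)               ≡⟨ E-apps-rigid (var x) Us refl ⟩
  apps (var x) (map E Us)           ≡⟨ cong (apps (var x)) (map-E-idempotent-below Us ih (n<1+n _)) ⟩
  apps (var x) (map E (map E Us))   ≡⟨ E-apps-rigid (var x) (map E Us) refl ⟨
  E (apps (var x) (map E Us))       ∎
  where open ≡-Reasoning
commutes-rigid (lam x u) Us _ ih = begin
  E (apps (lam x u) Us)                         ≡⟨ E-apps-rigid (lam x u) Us refl ⟩
  apps (lam x (E u)) (map E Us)                 ≡⟨ cong₂ (λ s ss → apps (lam x s) ss)
                                                     (E-idempotent-below u ih (s≤s (m≤m+n _ _)))
                                                     (map-E-idempotent-below Us ih (s≤s (m≤n+m _ _))) ⟩
  apps (lam x (E (E u))) (map E (map E Us))     ≡⟨ E-apps-rigid (lam x (E u)) (map E Us) refl ⟨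
  E (apps (lam x (E u)) (map E Us))             ∎
  where open ≡-Reasoning
commutes-rigid (app u v) Us eq ih = begin
  -- apps (app u v) Us is apps u (v ∷ Us), but with a smaller weight.
  E (apps u (v ∷ Us))                   ≡⟨ ih u (v ∷ Us) (s≤s (≤-reflexive (sym (+-assoc (size u) _ _)))) ⟩
  E (apps (app (E u) (E v)) (map E Us)) ≡⟨ cong (λ s → E (apps s (map E Us)))
                                             (E-app-rigid u v (hview-app-notH⁻ u eq)) ⟨
  E (apps (E (app u v)) (map E Us))     ∎
  where open ≡-Reasoning

commutes-step : ∀ T Us → CommutesBelow (weight T Us) → Commutes T Us
commutes-step T Us ih with hview T in eq
... | isH with refl ← hview-isH T eq = commutes-H Us ih
... | isHapp _ = commutes-isHapp T Us eq ih
... | notH     = commutes-rigid T Us eq ih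

commutesBelow : ∀ n → CommutesBelow n
commutesBelow (suc n) T Us (s≤s weight≤n) =
  commutes-step T Us (λ T′ Us′ lighter → commutesBelow n T′ Us′ (<-≤-trans lighter weight≤n))

lemma3p3 : (T : Term) (Us : List Term) →
    E (apps T Us) ≡ E (apps (E T) (map E Us))
lemma3p3 T Us = commutesBelow (suc (weight T Us)) T Us ≤-refl
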